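{- If $G$ is a trivially power-colorable finite graph with at least one edge, then $\chi(G)\ge 3$.
   Context: Graphs are undirected and simple; $\chi(G)$ is the chromatic number; a $k$-coloring is a proper coloring $V\to k=\{0,\dots,k-1\}$. The direct product $\times_{i\in I}G_i$ has vertex set $\times_i V(G_i)$ with $u,v$ adjacent iff $u_iv_i\in E(G_i)$ for all $i$; $G^n$ is the product of $n$ copies of $G$. A coloring $\Phi$ of $\times_{i\in I}G_i$ is trivial if there exist $i^*\in I$ and a coloring $\phi$ of $G_{i^*}$ with $\Phi(v)=\phi(v_{i^*})$ for all $v$. $G$ is trivially power-colorable if for every positive integer $n$, every $\chi(G^n)$-coloring of $G^n$ is trivial. -}

module Defs where

open import Data.Nat using (ℕ; suc; _≤_; _<_)
open import Data.Fin as Fin using (Fin)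
open import Data.Product using (Σ; ∃; _×_; _,_)
open import Relation.Binary.PropositionalEquality using (_≡_; _≢_)
open import Relation.Nullary using (¬_)

record Graph (V : Set) : Set₁ where
  field
    Adj   : V → V → Set
    sym   : ∀ {u v} → Adj u v → Adj v u
    irrefl : ∀ {v} → ¬ Adj v v
open Graph public

IsColoring : {V : Set} → Graph V → (k : ℕ) → (V → Fin k) → Set
IsColoring G k c = ∀ {u v} → Adj G u v → c u ≢ c v

Colorable : {V : Set} → Graph V → ℕ → Set
Colorable G k = Σ (_ → Fin k) (IsColoring G k)

IsChromaticNumber : {V : Set} → Graph V → ℕ → Set
IsChromaticNumber G k = Colorable G k × (∀ j → j < k → ¬ Colorable G j)

-- Direct power G^n for positive n = suc m (G^0 would have a loop, so n ≥ 1 as in the paper):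
-- vertices are n-tuples, adjacent iff adjacent in every coordinate.
PowerSuc : {V : Set} → Graph V → (m : ℕ) → Graph (Fin (suc m) → V)
PowerSuc G m = record
  { Adj = λ u v → ∀ i → Adj G (u i) (v i)
  ; sym = λ a i → sym G (a i)
  ; irrefl = λ a → irrefl G (a Fin.zero)
  }

IsTrivial : {V : Set} → (G : Graph V) → (m k : ℕ) → ((Fin (suc m) → V) → Fin k) → Set
IsTrivial {V} G m k Φ =
  Σ (Fin (suc m)) λ i → Σ (V → Fin k) λ φ → IsColoring G k φ × (∀ v → Φ v ≡ φ (v i))

TriviallyPowerColorable : {V : Set} → Graph V → Set
TriviallyPowerColorable G =
  ∀ (m k : ℕ) → IsChromaticNumber (PowerSuc G m) k →
  ∀ (Φ : _ → Fin k) → IsColoring (PowerSuc G m) k Φ → IsTrivial G m k Φ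

HasEdge : {V : Set} → Graph V → Set
HasEdge {V} G = Σ V λ u → Σ V λ v → Adj G u v

{-# OPTIONS --safe #-}
-- If G has an edge and is 2-colourable, then χ(G³) = 2 as well, and composing a
-- 2-colouring c of G with the majority vote gives a 2-colouring of G³: along an
-- edge every coordinate changes colour, and majority commutes with swapping the
-- two colours. It depends on no single coordinate, since a vertex whose i-th
-- coordinate is u and whose other two are a neighbour w of u gets colour c w,
-- not c u.
module Submission where

open import Defs
open import Data.Nat using (ℕ; suc; _≤_; _<_; z≤n; s≤s)
open import Data.Fin using (Fin; opposite)
open import Data.Fin.Properties using (¬Fin0)
open import Data.Vec.Functional using (updateAt)
open import Data.Vec.Functional.Properties using (updateAt-updates; updateAt-minimal)
open import Data.Product using (_,_)
open import Data.Empty using (⊥-elim)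
open import Function using (_∘_; const)
open import Relation.Binary.PropositionalEquality
  using (_≡_; _≢_; refl; trans; cong; cong₂; module ≡-Reasoning)
open import Relation.Nullary using (¬_)

open ≡-Reasoning

pattern 0F = Fin.zero
pattern 1F = Fin.suc Fin.zero
pattern 2F = Fin.suc (Fin.suc Fin.zero)

opposite-≢ : (x : Fin 2) → x ≢ opposite x
opposite-≢ 0F ()
opposite-≢ 1F ()

≢⇒≡opposite : {x y : Fin 2} → x ≢ y → y ≡ opposite x
≢⇒≡opposite {0F} {0F} x≢y = ⊥-elim (x≢y refl)
≢⇒≡opposite {0F} {1F} _   = refl
≢⇒≡opposite {1F} {0F} _   = refl
≢⇒≡opposite {1F} {1F} x≢y = ⊥-elim (x≢y refl)

maj : Fin 2 → Fin 2 → Fin 2 → Fin 2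
maj 0F 0F _ = 0F
maj 1F 1F _ = 1F
maj _  _  z = z

maj-opposite : ∀ x y z → maj (opposite x) (opposite y) (opposite z) ≡ opposite (maj x y z)
maj-opposite 0F 0F _ = refl
maj-opposite 0F 1F _ = refl
maj-opposite 1F 0F _ = refl
maj-opposite 1F 1F _ = refl

majority : (Fin 3 → Fin 2) → Fin 2
majority f = maj (f 0F) (f 1F) (f 2F)

majority-cong : ∀ {f g} → (∀ i → f i ≡ g i) → majority f ≡ majority g
majority-cong f≗g rewrite f≗g 0F | f≗g 1F | f≗g 2F = refl

majority-opposite : ∀ f → majority (opposite ∘ f) ≡ opposite (majority f)
majority-opposite f = maj-opposite (f 0F) (f 1F) (f 2F)

majority-outvoted : ∀ f i {b} → (∀ j → j ≢ i → f j ≡ b) → majority f ≡ b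
majority-outvoted f 0F agree = trans (cong₂ (maj (f 0F)) (agree 1F λ ()) (agree 2F λ ())) (maj-xbb _ _)
  where
  maj-xbb : ∀ x b → maj x b b ≡ b
  maj-xbb 0F 0F = refl
  maj-xbb 0F 1F = refl
  maj-xbb 1F 0F = refl
  maj-xbb 1F 1F = refl
majority-outvoted f 1F agree = trans (cong₂ (λ a c → maj a (f 1F) c) (agree 0F λ ()) (agree 2F λ ())) (maj-bxb _ _)
  where
  maj-bxb : ∀ x b → maj b x b ≡ b
  maj-bxb 0F 0F = refl
  maj-bxb 0F 1F = refl
  maj-bxb 1F 0F = refl
  maj-bxb 1F 1F = refl
majority-outvoted f 2F agree = trans (cong₂ (λ a b → maj a b (f 2F)) (agree 0F λ ()) (agree 1F λ ())) (maj-bbx _ _)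
  where
  maj-bbx : ∀ x b → maj b b x ≡ b
  maj-bbx 0F 0F = refl
  maj-bbx 0F 1F = refl
  maj-bbx 1F 0F = refl
  maj-bbx 1F 1F = refl

HasEdge⇒¬Colorable : {V : Set} (G : Graph V) → HasEdge G → ∀ j → j < 2 → ¬ Colorable G j
HasEdge⇒¬Colorable G (u , w , u~w) 0       _ (c , _)      = ¬Fin0 (c u)
HasEdge⇒¬Colorable G (u , w , u~w) 1       _ (c , proper) = proper u~w (Fin1-unique (c u) (c w))
  where
  Fin1-unique : (x y : Fin 1) → x ≡ y
  Fin1-unique 0F 0F = refl
HasEdge⇒¬Colorable G _ (suc (suc _)) (s≤s (s≤s ()))

HasEdge⇒chromaticNumber-two : {V : Set} (G : Graph V) → HasEdge G → Colorable G 2 → IsChromaticNumber G 2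
HasEdge⇒chromaticNumber-two G edge col = col , HasEdge⇒¬Colorable G edge

module _ {V : Set} (G : Graph V) where

  HasEdge-power : ∀ m → HasEdge G → HasEdge (PowerSuc G m)
  HasEdge-power m (u , w , u~w) = const u , const w , const u~w

  Colorable-power : ∀ m {k} → Colorable G k → Colorable (PowerSuc G m) k
  Colorable-power m (c , proper) = c ∘ (λ v → v 0F) , λ adj → proper (adj 0F)

  proper-2-coloring-swaps : ∀ {c u v} → IsColoring G 2 c → Adj G u v → c v ≡ opposite (c u)
  proper-2-coloring-swaps proper u~v = ≢⇒≡opposite (proper u~v)

  module MajorityColoring (c : V → Fin 2) (proper : IsColoring G 2 c) where

    Φ : (Fin 3 → V) → Fin 2
    Φ v = majority (c ∘ v)

    Φ-proper : IsColoring (PowerSuc G 2) 2 Φ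
    Φ-proper {x} {y} adj Φx≡Φy = opposite-≢ (Φ x) (begin
      Φ x                         ≡⟨ Φx≡Φy ⟩
      Φ y                         ≡⟨ majority-cong (λ i → proper-2-coloring-swaps proper (adj i)) ⟩
      majority (opposite ∘ c ∘ x) ≡⟨ majority-opposite (c ∘ x) ⟩
      opposite (Φ x)              ∎)

    Φ-nontrivial : HasEdge G → ¬ IsTrivial G 2 2 Φ
    Φ-nontrivial (u , w , u~w) (i , φ , _ , factors) = proper u~w (begin
      c u           ≡⟨ majority-outvoted (const (c u)) 0F (λ _ _ → refl) ⟨
      Φ (const u)   ≡⟨ factors (const u) ⟩
      φ u           ≡⟨ cong φ (updateAt-updates i (const w)) ⟨
      φ (spike i)   ≡⟨ factors spike ⟨
      Φ spike       ≡⟨ majority-outvoted (c ∘ spike) i (λ j j≢i → cong c (updateAt-minimal j i (const w) j≢i)) ⟩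
      c w           ∎)
      where
      spike : Fin 3 → V
      spike = updateAt (const w) i (const u)

  ¬Colorable-two : TriviallyPowerColorable G → HasEdge G → ¬ Colorable G 2
  ¬Colorable-two tpc edge col@(c , proper) =
    Φ-nontrivial edge (tpc 2 2 χ[G³]≡2 Φ Φ-proper)
    where
    open MajorityColoring c proper
    χ[G³]≡2 : IsChromaticNumber (PowerSuc G 2) 2
    χ[G³]≡2 = HasEdge⇒chromaticNumber-two (PowerSuc G 2) (HasEdge-power 2 edge) (Colorable-power 2 col)

mainTheorem5 : (m : ℕ) (G : Graph (Fin m)) → TriviallyPowerColorable G → HasEdge G →
    (k : ℕ) → IsChromaticNumber G k → 3 ≤ k
mainTheorem5 m G tpc edge 0 (col , _) = ⊥-elim (HasEdge⇒¬Colorable G edge 0 (s≤s z≤n) col)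
mainTheorem5 m G tpc edge 1 (col , _) = ⊥-elim (HasEdge⇒¬Colorable G edge 1 (s≤s (s≤s z≤n)) col)
mainTheorem5 m G tpc edge 2 (col , _) = ⊥-elim (¬Colorable-two G tpc edge col)
mainTheorem5 m G tpc edge (suc (suc (suc k))) _ = s≤s (s≤s (s≤s z≤n))
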